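{- The line graph of the incidence graph of the projective plane of order $3$ is not a Cayley graph.
   Context: The projective plane of order $3$ is $PG(2,3)$ (unique up to isomorphism), with $13$ points and $13$ lines; its incidence graph is the bipartite graph on points and lines with adjacency given by incidence. A graph is a Cayley graph if it is isomorphic to some $\mathrm{Cay}(G,S)$, where $G$ is a finite group, $S\subseteq G\setminus\{e\}$ is inverse-closed, and $a\sim b$ iff $ab^{ -1}\in S$. -}

module Defs where

open import Level using (0ℓ)
open import Data.Bool using (Bool; true; false; _∧_)
open import Data.Nat using (ℕ; _+_; _*_; _%_; _≡ᵇ_)
open import Data.Fin using (Fin; zero; suc; toℕ)
open import Data.Product using (Σ; ∃; _×_; _,_)
open import Data.Sum using (_⊎_)
open import Relation.Nullary using (¬_)
open import Relation.Binary.PropositionalEquality using (_≡_) renaming (setoid to ≡-setoid)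
open import Algebra.Bundles using (Group)
open import Function.Bundles using (Bijection; _⇔_)

F₃ : Set
F₃ = Fin 3

Vec3 : Set
Vec3 = F₃ × F₃ × F₃

-- A nonzero vector is normalised if its first nonzero coordinate is 1;
-- normalised vectors are canonical representatives of the 1-dimensional
-- subspaces of F₃³ (13 of them).
normalised : Vec3 → Bool
normalised (suc zero , _ , _) = true
normalised (zero , suc zero , _) = true
normalised (zero , zero , suc zero) = true
normalised _ = false

Point : Set
Point = Σ Vec3 (λ v → normalised v ≡ true)

-- Lines of PG(2,3): 2-dimensional subspaces of F₃³, represented by their
-- normal vector (the 1-dimensional orthogonal complement).
Line : Set
Line = Σ Vec3 (λ v → normalised v ≡ true)

dot : Vec3 → Vec3 → ℕ
dot (a , b , c) (x , y , z) = toℕ a * toℕ x + toℕ b * toℕ y + toℕ c * toℕ z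

Incident : Point → Line → Set
Incident (v , _) (w , _) = ((dot v w % 3) ≡ᵇ 0) ≡ true

-- The edges of the (bipartite) incidence graph are exactly the flags
-- (p , ℓ) with p incident to ℓ; two edges are adjacent in the line graph
-- iff they are distinct and share an endpoint (same point or same line).

Flag : Set
Flag = Σ (Point × Line) (λ { (p , l) → Incident p l })

LineGraphAdj : Flag → Flag → Set
LineGraphAdj ((p , l) , _) ((p' , l') , _) =
  ¬ ((p , l) ≡ (p' , l')) × (p ≡ p' ⊎ l ≡ l')

-- A graph (V , adj) is a Cayley graph if there are a group G, an
-- inverse-closed subset S ⊆ G ∖ {e}, and a graph isomorphism
-- (a bijection f : V → G) such that  u ~ v  ⇔  f u · (f v)⁻¹ ∈ S.
-- (G is a group whose equality is the setoid equality _≈_; S must respect it.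
-- Finiteness of G is automatic, since G is in bijection with V.)

record CayleyData (V : Set) (adj : V → V → Set) : Set₁ where
  field
    G : Group 0ℓ 0ℓ
  open Group G
  field
    S          : Carrier → Set
    S-resp     : ∀ {x y} → x ≈ y → S x → S y
    S-inv      : ∀ x → S x → S (x ⁻¹)
    S-no-e     : ¬ S ε
    iso        : Bijection (≡-setoid V) (Group.setoid G)
    iso-adj    : ∀ u v →
                 adj u v ⇔ S (Bijection.to iso u ∙ Bijection.to iso v ⁻¹)

IsCayleyGraph : (V : Set) → (V → V → Set) → Set₁
IsCayleyGraph V adj = CayleyData V adj

-- A Cayley graph on the 52 flags of PG(2,3) comes from a group of even order, which contains an
-- involution t; right multiplication by t is a fixed-point-free involutive automorphism σ of the
-- graph. In the line graph of the incidence graph the neighbours of a flag form two cliques (flags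
-- through the same point, flags on the same line), so σ either preserves the two kinds of adjacency
-- or swaps them, and by connectedness it does so uniformly. If it preserves them, σ induces an
-- involutory collineation without fixed flags; but such a map fixes a line m, hence every point off m
-- (a moved point p would give a second fixed line p ∨ σp, meeting m in a fixed point), and two points
-- off m span a second fixed line. If it swaps them, σ induces a polarity π without absolute points,
-- and (q , l) ↦ (l ∧ π q , π q) permutes the flags in orbits of size 3, so 3 would divide 52.

module Submission where

-- Point, Line and Flag are opened again further down: the fields of ProjectivePlane would clash with them.
open import Defs hiding (Point; Line; Flag)

open import Level using (0ℓ)
open import Algebra.Bundles using (Group)
open import Data.Bool using (Bool; true; false; not; _xor_)
import Data.Bool as Bool
open import Data.Bool.Properties using (¬-not)
open import Data.Empty using (⊥; ⊥-elim)
open import Data.Fin using (zero; suc; toℕ)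
import Data.Fin as Fin
open import Data.List
  using (List; []; _∷_; [_]; _++_; length; filter; map; cartesianProduct; allFin; find; concatMap)
open import Data.List.Properties using (length-++)
open import Data.List.Membership.Propositional using (_∈_; _∉_; lose)
open import Data.List.Membership.Propositional.Properties
  using ( ∈-++⁺ˡ; ∈-++⁺ʳ; ∈-++⁻; ∈-filter⁺; ∈-filter⁻; ∈-length
        ; ∈-map⁺; ∈-cartesianProduct⁺; ∈-allFin; ∈-concatMap⁺)
open import Data.List.Membership.Propositional.Properties.WithK using (unique∧set⇒bag)
open import Data.List.Relation.Binary.BagAndSetEquality using (∼bag⇒↭)
open import Data.List.Relation.Binary.Permutation.Propositional using (_↭_)
open import Data.List.Relation.Binary.Permutation.Propositional.Properties using (↭-length)
open import Data.List.Relation.Binary.Subset.Propositional using (_⊆_)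
open import Data.List.Relation.Unary.Any using (here; there; any?; satisfied)
import Data.List.Relation.Unary.Any as Any
open import Data.List.Relation.Unary.All using ([]; _∷_)
import Data.List.Relation.Unary.All as All
open import Data.List.Relation.Unary.Unique.Propositional using (Unique; []; _∷_)
open import Data.List.Relation.Unary.Unique.Propositional.Properties using (++⁺; filter⁺)
open import Data.List.Relation.Unary.Unique.DecPropositional using (unique?)
open import Data.Maybe using (fromMaybe)
open import Data.Nat using (ℕ; _+_; _%_; _≡ᵇ_; _<_)
open import Data.Nat.Divisibility using (_∣_; _∣?_; _∣0; ∣-refl; ∣m∣n⇒∣m+n; ∣m+n∣m⇒∣n; ∣1⇒≡1)
open import Data.Nat.Induction using (<-wellFounded)
open import Data.Nat.Properties using (m<n+m; +-comm; *-comm)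
open import Data.Product using (Σ; ∃; _×_; _,_; proj₁; proj₂)
open import Data.Product.Properties using (≡-dec)
open import Data.Sum using (_⊎_; inj₁; inj₂; [_,_]′)
open import Function using (_∘_)
open import Function.Bundles using (Bijection; Equivalence; mk⇔)
open import Induction.WellFounded using (Acc; acc)
open import Relation.Nullary using (¬_; Dec; yes; no; does; ¬?; _×-dec_; _→-dec_; Irrelevant; contradiction)
open import Relation.Nullary.Decidable using (map′; from-yes; from-no)
open import Relation.Unary using (Decidable)
open import Relation.Binary.Definitions using (DecidableEquality)
open import Relation.Binary.PropositionalEquality
  using (_≡_; _≢_; refl; sym; trans; cong; cong₂; subst; subst₂; module ≡-Reasoning)
open import Relation.Binary.PropositionalEquality.WithK using (≡-irrelevant)

-- Counting with blocks

module _ {A : Set} (_≟_ : DecidableEquality A) where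
  open import Data.List.Membership.DecPropositional _≟_ using (_∈?_)

  infixl 6 _∖_

  _∉?_ : ∀ x ys → Dec (x ∉ ys)
  x ∉? ys = ¬? (x ∈? ys)

  _∖_ : List A → List A → List A
  xs ∖ ys = filter (_∉? ys) xs

  ↭-++-∖ : ∀ {xs ys} → Unique xs → Unique ys → ys ⊆ xs → xs ↭ ys ++ xs ∖ ys
  ↭-++-∖ {xs} {ys} xs! ys! ys⊆xs =
    ∼bag⇒↭ (unique∧set⇒bag xs! (++⁺ ys! (filter⁺ _ xs!) disjoint) (mk⇔ split merge))
    where
    disjoint : ∀ {x} → ¬ (x ∈ ys × x ∈ xs ∖ ys)
    disjoint (x∈ys , x∈rest) = proj₂ (∈-filter⁻ (_∉? ys) {xs = xs} x∈rest) x∈ys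
    split : ∀ {x} → x ∈ xs → x ∈ ys ++ xs ∖ ys
    split {x} x∈xs with x ∈? ys
    ... | yes x∈ys = ∈-++⁺ˡ x∈ys
    ... | no x∉ys = ∈-++⁺ʳ ys (∈-filter⁺ _ x∈xs x∉ys)
    merge : ∀ {x} → x ∈ ys ++ xs ∖ ys → x ∈ xs
    merge = [ ys⊆xs , proj₁ ∘ ∈-filter⁻ (_∉? ys) {xs = xs} ]′ ∘ ∈-++⁻ ys

  length-∖ : ∀ {xs ys} → Unique xs → Unique ys → ys ⊆ xs → length xs ≡ length ys + length (xs ∖ ys)
  length-∖ {xs} {ys} xs! ys! ys⊆xs = trans (↭-length (↭-++-∖ xs! ys! ys⊆xs)) (length-++ ys)

  module Blocks
    (block : A → List A) (k : ℕ)
    (length-block : ∀ x → length (block x) ≡ k)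
    (block-refl : ∀ x → x ∈ block x)
    (block-sym : ∀ {x y} → y ∈ block x → x ∈ block y)
    (block-trans : ∀ {x y z} → y ∈ block x → z ∈ block y → z ∈ block x)
    where

    BlockClosed : List A → Set
    BlockClosed xs = ∀ {x y} → x ∈ xs → y ∈ block x → y ∈ xs

    block-closed⇒k∣length : ∀ xs → Unique xs → BlockClosed xs →
                            (∀ {x} → x ∈ xs → Unique (block x)) → k ∣ length xs
    block-closed⇒k∣length xs = go xs (<-wellFounded (length xs))
      where
      go : ∀ xs → Acc _<_ (length xs) → Unique xs → BlockClosed xs →
           (∀ {x} → x ∈ xs → Unique (block x)) → k ∣ length xs
      go []           _         _   _      _       = k ∣0
      go xs@(x ∷ _) (acc rec) xs! closed blocks! = subst (k ∣_) (sym |xs|) (∣m∣n⇒∣m+n ∣-refl k∣|rest|)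
        where
        rest : List A
        rest = xs ∖ block x
        rest⊆xs : rest ⊆ xs
        rest⊆xs = proj₁ ∘ ∈-filter⁻ (_∉? block x) {xs = xs}
        |xs|′ : length xs ≡ length (block x) + length rest
        |xs|′ = length-∖ xs! (blocks! (here refl)) (closed (here refl))
        |xs| : length xs ≡ k + length rest
        |xs| = trans |xs|′ (cong (_+ length rest) (length-block x))
        shorter : length rest < length xs
        shorter = subst (length rest <_) (sym |xs|′) (m<n+m _ (∈-length (block-refl x)))
        rest-closed : BlockClosed rest
        rest-closed y∈rest z∈block-y =
          ∈-filter⁺ (_∉? block x) (closed (rest⊆xs y∈rest) z∈block-y)
            λ z∈block-x → proj₂ (∈-filter⁻ (_∉? block x) {xs = xs} y∈rest)
                            (block-trans z∈block-x (block-sym z∈block-y))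
        k∣|rest| : k ∣ length rest
        k∣|rest| = go rest (rec shorter) (filter⁺ (_∉? block x) xs!) rest-closed (blocks! ∘ rest⊆xs)

  module _ (ψ : A → A) (ψ-involutive : ∀ x → ψ (ψ x) ≡ x) where

    orbit₂ : A → List A
    orbit₂ x = x ∷ ψ x ∷ []

    private
      orbit₂-sym : ∀ {x y} → y ∈ orbit₂ x → x ∈ orbit₂ y
      orbit₂-sym (here refl)         = here refl
      orbit₂-sym (there (here refl)) = there (here (sym (ψ-involutive _)))

      orbit₂-trans : ∀ {x y z} → y ∈ orbit₂ x → z ∈ orbit₂ y → z ∈ orbit₂ x
      orbit₂-trans (here refl)         z∈                  = z∈
      orbit₂-trans (there (here refl)) (here refl)         = there (here refl)
      orbit₂-trans (there (here refl)) (there (here refl)) = here (ψ-involutive _)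

      open Blocks orbit₂ 2 (λ _ → refl) (λ _ → here refl) orbit₂-sym orbit₂-trans

    fixed-point-free-involution⇒2∣length :
      ∀ xs → Unique xs → (∀ {x} → x ∈ xs → ψ x ∈ xs) → (∀ {x} → x ∈ xs → ψ x ≢ x) → 2 ∣ length xs
    fixed-point-free-involution⇒2∣length xs xs! ψ-closed ψ-free =
      block-closed⇒k∣length xs xs! closed (λ x∈xs → ((ψ-free x∈xs ∘ sym) ∷ []) ∷ [] ∷ [])
      where
      closed : BlockClosed xs
      closed x∈xs (here refl)         = x∈xs
      closed x∈xs (there (here refl)) = ψ-closed x∈xs

    involution-second-fixed-point : ∀ xs → Unique xs → (∀ x → x ∈ xs) → 2 ∣ length xs →
                                    ∀ {e} → ψ e ≡ e → ∃ λ x → x ≢ e × ψ x ≡ x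
    involution-second-fixed-point xs xs! complete 2∣|xs| {e} ψe≡e
      with any? (λ x → ¬? (x ≟ e) ×-dec (ψ x ≟ x)) xs
    ... | yes found = satisfied found
    ... | no none   = ⊥-elim (2∤1 (∣m+n∣m⇒∣n 2∣|ys|+1 2∣|ys|))
      where
      ys : List A
      ys = xs ∖ [ e ]
      ys⊆xs : ys ⊆ xs
      ys⊆xs = proj₁ ∘ ∈-filter⁻ (_∉? [ e ]) {xs = xs}
      ys-≢ : ∀ {y} → y ∈ ys → y ≢ e
      ys-≢ {y} y∈ys y≡e = proj₂ (∈-filter⁻ (_∉? [ e ]) {xs = xs} y∈ys) (here y≡e)
      2∣|ys|+1 : 2 ∣ length ys + 1
      2∣|ys|+1 = subst (2 ∣_) (trans |xs| (+-comm 1 _)) 2∣|xs|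
        where
        |xs| : length xs ≡ 1 + length ys
        |xs| = length-∖ xs! ([] ∷ []) λ { (here refl) → complete e }
      2∣|ys| : 2 ∣ length ys
      2∣|ys| = fixed-point-free-involution⇒2∣length ys (filter⁺ (_∉? [ e ]) xs!)
        (λ {y} y∈ys → ∈-filter⁺ (_∉? [ e ]) (complete (ψ y))
           λ { (here ψy≡e) → ys-≢ y∈ys (trans (sym (ψ-involutive y)) (trans (cong ψ ψy≡e) ψe≡e)) })
        (λ y∈ys ψy≡y → none (lose (ys⊆xs y∈ys) (ys-≢ y∈ys , ψy≡y)))
      2∤1 : ¬ 2 ∣ 1
      2∤1 2∣1 with ∣1⇒≡1 2∣1
      ... | ()

  module _ (φ : A → A) (φ³≡id : ∀ x → φ (φ (φ x)) ≡ x) where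

    orbit₃ : A → List A
    orbit₃ x = x ∷ φ x ∷ φ (φ x) ∷ []

    private
      orbit₃-sym : ∀ {x y} → y ∈ orbit₃ x → x ∈ orbit₃ y
      orbit₃-sym (here refl)                 = here refl
      orbit₃-sym (there (here refl))         = there (there (here (sym (φ³≡id _))))
      orbit₃-sym (there (there (here refl))) = there (here (sym (φ³≡id _)))

      orbit₃-trans : ∀ {x y z} → y ∈ orbit₃ x → z ∈ orbit₃ y → z ∈ orbit₃ x
      orbit₃-trans (here refl)         z∈                                  = z∈
      orbit₃-trans (there (here refl)) (here refl)                 = there (here refl)
      orbit₃-trans (there (here refl)) (there (here refl))         = there (there (here refl))
      orbit₃-trans (there (here refl)) (there (there (here refl))) = here (φ³≡id _)
      orbit₃-trans (there (there (here refl))) (here refl)                 = there (there (here refl))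
      orbit₃-trans (there (there (here refl))) (there (here refl))         = here (φ³≡id _)
      orbit₃-trans (there (there (here refl))) (there (there (here refl))) = there (here (cong φ (φ³≡id _)))

      open Blocks orbit₃ 3 (λ _ → refl) (λ _ → here refl) orbit₃-sym orbit₃-trans

    fixed-point-free-order-3⇒3∣length :
      (∀ x → φ x ≢ x) → ∀ xs → Unique xs → (∀ x → x ∈ xs) → 3 ∣ length xs
    fixed-point-free-order-3⇒3∣length φ-free xs xs! complete =
      block-closed⇒k∣length xs xs! (λ _ _ → complete _) λ {x} _ → orbit₃-unique x
      where
      orbit₃-unique : ∀ x → Unique (orbit₃ x)
      orbit₃-unique x = (x≢φx ∷ x≢φφx ∷ []) ∷ (φ-free (φ x) ∘ sym ∷ []) ∷ [] ∷ []
        where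
        x≢φx : x ≢ φ x
        x≢φx = φ-free x ∘ sym
        x≢φφx : x ≢ φ (φ x)
        x≢φφx x≡φφx = φ-free x (trans (cong φ x≡φφx) (φ³≡id x))

-- Cayley graphs of even order

record FixedPointFreeInvolution (V : Set) (adj : V → V → Set) : Set where
  field
    σ                  : V → V
    σ-involutive       : ∀ x → σ (σ x) ≡ x
    σ-fixed-point-free : ∀ x → σ x ≢ x
    σ-adj              : ∀ {x y} → adj x y → adj (σ x) (σ y)

module _ (G : Group 0ℓ 0ℓ) where
  open Group G renaming (refl to ≈-refl; sym to ≈-sym)
  open import Algebra.Properties.Group G using (//-rightDividesʳ; \\-leftDividesˡ; ⁻¹-anti-homo-∙)
  open import Relation.Binary.Reasoning.Setoid setoid

  //-invariantʳ : ∀ a b t → (a ∙ t) // (b ∙ t) ≈ a // b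
  //-invariantʳ a b t = begin
    (a ∙ t) ∙ (b ∙ t) ⁻¹     ≈⟨ ∙-cong ≈-refl (⁻¹-anti-homo-∙ b t) ⟩
    (a ∙ t) ∙ (t ⁻¹ ∙ b ⁻¹)  ≈⟨ assoc a t _ ⟩
    a ∙ (t ∙ (t ⁻¹ ∙ b ⁻¹))  ≈⟨ ∙-cong ≈-refl (\\-leftDividesˡ t (b ⁻¹)) ⟩
    a ∙ b ⁻¹                 ∎

  self-inverse-cancelʳ : ∀ {t} → t ⁻¹ ≈ t → ∀ a → (a ∙ t) ∙ t ≈ a
  self-inverse-cancelʳ {t} t⁻¹≈t a = begin
    (a ∙ t) ∙ t   ≈⟨ ∙-cong ≈-refl (≈-sym t⁻¹≈t) ⟩
    (a ∙ t) // t  ≈⟨ //-rightDividesʳ t a ⟩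
    a             ∎

cayley⇒fixed-point-free-involution :
  ∀ {V adj} → IsCayleyGraph V adj → DecidableEquality V →
  ∀ xs → Unique xs → (∀ x → x ∈ xs) → 2 ∣ length xs → FixedPointFreeInvolution V adj
cayley⇒fixed-point-free-involution {V} {adj} C _≟_ xs xs! complete 2∣|xs| = record
  { σ = σ ; σ-involutive = σ-involutive ; σ-fixed-point-free = σ-fixed-point-free ; σ-adj = σ-adj }
  where
  open CayleyData C
  open Group G renaming (refl to ≈-refl; sym to ≈-sym; trans to ≈-trans)
  open import Algebra.Properties.Group G using (ε⁻¹≈ε; ⁻¹-involutive; identityʳ-unique)
  open import Relation.Binary.Reasoning.Setoid setoid

  f : V → Carrier
  f = Bijection.to iso

  f-cong : ∀ {x y} → x ≡ y → f x ≈ f y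
  f-cong = Bijection.cong iso

  f-injective : ∀ {x y} → f x ≈ f y → x ≡ y
  f-injective = Bijection.injective iso

  f⁻¹ : Carrier → V
  f⁻¹ g = proj₁ (Bijection.strictlySurjective iso g)

  f∘f⁻¹ : ∀ g → f (f⁻¹ g) ≈ g
  f∘f⁻¹ g = proj₂ (Bijection.strictlySurjective iso g)

  e : V
  e = f⁻¹ ε

  ι : V → V
  ι x = f⁻¹ (f x ⁻¹)

  ι-involutive : ∀ x → ι (ι x) ≡ x
  ι-involutive x = f-injective (begin
    f (ι (ι x))  ≈⟨ f∘f⁻¹ _ ⟩
    f (ι x) ⁻¹   ≈⟨ ⁻¹-cong (f∘f⁻¹ _) ⟩
    f x ⁻¹ ⁻¹    ≈⟨ ⁻¹-involutive (f x) ⟩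
    f x          ∎)

  ι-e : ι e ≡ e
  ι-e = f-injective (begin
    f (ι e)  ≈⟨ f∘f⁻¹ _ ⟩
    f e ⁻¹   ≈⟨ ⁻¹-cong (f∘f⁻¹ ε) ⟩
    ε ⁻¹     ≈⟨ ε⁻¹≈ε ⟩
    ε        ≈⟨ f∘f⁻¹ ε ⟨
    f e      ∎)

  involution : ∃ λ x → x ≢ e × ι x ≡ x
  involution = involution-second-fixed-point _≟_ ι ι-involutive xs xs! complete 2∣|xs| ι-e

  t : Carrier
  t = f (proj₁ involution)

  t⁻¹≈t : t ⁻¹ ≈ t
  t⁻¹≈t = begin
    t ⁻¹                   ≈⟨ f∘f⁻¹ _ ⟨
    f (ι (proj₁ involution)) ≈⟨ f-cong (proj₂ (proj₂ involution)) ⟩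
    t                      ∎

  t≉ε : ¬ t ≈ ε
  t≉ε t≈ε = proj₁ (proj₂ involution) (f-injective (≈-trans t≈ε (≈-sym (f∘f⁻¹ ε))))

  σ : V → V
  σ x = f⁻¹ (f x ∙ t)

  f∘σ : ∀ x → f (σ x) ≈ f x ∙ t
  f∘σ x = f∘f⁻¹ _

  σ-involutive : ∀ x → σ (σ x) ≡ x
  σ-involutive x = f-injective (begin
    f (σ (σ x))    ≈⟨ f∘σ (σ x) ⟩
    f (σ x) ∙ t    ≈⟨ ∙-cong (f∘σ x) ≈-refl ⟩
    (f x ∙ t) ∙ t  ≈⟨ self-inverse-cancelʳ G t⁻¹≈t (f x) ⟩
    f x            ∎)

  σ-fixed-point-free : ∀ x → σ x ≢ x
  σ-fixed-point-free x σx≡x = t≉ε (identityʳ-unique (f x) t (begin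
    f x ∙ t  ≈⟨ f∘σ x ⟨
    f (σ x)  ≈⟨ f-cong σx≡x ⟩
    f x      ∎))

  σ-adj : ∀ {x y} → adj x y → adj (σ x) (σ y)
  σ-adj {x} {y} x~y = Equivalence.from (iso-adj (σ x) (σ y))
    (S-resp (≈-sym quotient-invariant) (Equivalence.to (iso-adj x y) x~y))
    where
    quotient-invariant : f (σ x) ∙ f (σ y) ⁻¹ ≈ f x ∙ f y ⁻¹
    quotient-invariant = begin
      f (σ x) ∙ f (σ y) ⁻¹       ≈⟨ ∙-cong (f∘σ x) (⁻¹-cong (f∘σ y)) ⟩
      (f x ∙ t) ∙ (f y ∙ t) ⁻¹   ≈⟨ //-invariantʳ G (f x) (f y) t ⟩
      f x ∙ f y ⁻¹               ∎

-- Projective planes and the line graph of their incidence graph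

xor-≡ : ∀ {a b c d} → (a ≡ b → c ≡ d) → (c ≡ d → a ≡ b) → a xor c ≡ b xor d
xor-≡ {false} {false} to _ = to refl
xor-≡ {true}  {true}  to _ = cong not (to refl)
xor-≡ {false} {true}  _ from = ¬-not (λ c≡d → contradiction (from c≡d) λ ())
xor-≡ {true}  {false} _ from = sym (¬-not (λ d≡c → contradiction (from (sym d≡c)) λ ()))

xor≡false⇒≡ : ∀ {a b} → a xor b ≡ false → b ≡ a
xor≡false⇒≡ {false}         eq = eq
xor≡false⇒≡ {true}  {true}  _  = refl

xor≡true⇒≡not : ∀ {a b} → a xor b ≡ true → b ≡ not a
xor≡true⇒≡not {false}         eq = eq
xor≡true⇒≡not {true}  {false} _  = refl

record ProjectivePlane : Set₁ where
  infix 4 _I_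
  field
    Point Line   : Set
    _I_          : Point → Line → Set
    I-irrelevant : ∀ {p l} → Irrelevant (p I l)
    _≟ₚ_         : DecidableEquality Point
    _≟ₗ_         : DecidableEquality Line

    join        : Point → Point → Line
    join-I₁     : ∀ p q → p I join p q
    join-I₂     : ∀ p q → q I join p q
    join-unique : ∀ {p q l} → p ≢ q → p I l → q I l → l ≡ join p q

    meet        : Line → Line → Point
    meet-I₁     : ∀ l m → meet l m I l
    meet-I₂     : ∀ l m → meet l m I m
    meet-unique : ∀ {l m p} → l ≢ m → p I l → p I m → p ≡ meet l m

    line₀       : Line
    off₁ off₂   : Line → Point
    off₁-∉      : ∀ l → ¬ off₁ l I l
    off₂-∉      : ∀ l → ¬ off₂ l I l
    off₁≢off₂   : ∀ l → off₁ l ≢ off₂ l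

module ProjectivePlaneProperties (𝒫 : ProjectivePlane) where
  open ProjectivePlane 𝒫

  join-comm : ∀ p q → join p q ≡ join q p
  join-comm p q with p ≟ₚ q
  ... | yes refl = refl
  ... | no p≢q   = join-unique (p≢q ∘ sym) (join-I₂ p q) (join-I₁ p q)

  ∈-∉⇒≢ : ∀ {p k l} → p I k → ¬ p I l → k ≢ l
  ∈-∉⇒≢ p∈k p∉l refl = p∉l p∈k

  module Collineation
    (α : Point → Point) (β : Line → Line)
    (α-involutive : ∀ p → α (α p) ≡ p)
    (I-preserved  : ∀ {p l} → p I l → α p I β l)
    where

    β-join : ∀ {p q} → p ≢ q → β (join p q) ≡ join (α p) (α q)
    β-join {p} {q} p≢q =
      join-unique (p≢q ∘ α-injective) (I-preserved (join-I₁ p q)) (I-preserved (join-I₂ p q))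
      where
      α-injective : α p ≡ α q → p ≡ q
      α-injective αp≡αq = trans (sym (α-involutive p)) (trans (cong α αp≡αq) (α-involutive q))

    moved-point-line-fixed : ∀ {p} → p ≢ α p → β (join p (α p)) ≡ join p (α p)
    moved-point-line-fixed {p} p≢αp = begin
      β (join p (α p))        ≡⟨ β-join p≢αp ⟩
      join (α p) (α (α p))    ≡⟨ cong (join (α p)) (α-involutive p) ⟩
      join (α p) p            ≡⟨ join-comm (α p) p ⟩
      join p (α p)            ∎
      where open ≡-Reasoning

    fixed-points-line-fixed : ∀ {p q} → α p ≡ p → α q ≡ q → p ≢ q → β (join p q) ≡ join p q
    fixed-points-line-fixed αp≡p αq≡q p≢q = trans (β-join p≢q) (cong₂ join αp≡p αq≡q)

    fixed-line-through : ∀ {p q} → p ≢ q → Σ Line λ l → β l ≡ l × (p I l ⊎ q I l)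
    fixed-line-through {p} {q} p≢q with p ≟ₚ α p | q ≟ₚ α q
    ... | no p≢αp  | _        = join p (α p) , moved-point-line-fixed p≢αp , inj₁ (join-I₁ p (α p))
    ... | yes _    | no q≢αq  = join q (α q) , moved-point-line-fixed q≢αq , inj₂ (join-I₁ q (α q))
    ... | yes p≡αp | yes q≡αq =
      join p q , fixed-points-line-fixed (sym p≡αp) (sym q≡αq) p≢q , inj₁ (join-I₁ p q)

    fixed-lines-meet-fixed : ∀ {k l} → β k ≡ k → β l ≡ l → k ≢ l → α (meet k l) ≡ meet k l
    fixed-lines-meet-fixed {k} {l} βk≡k βl≡l k≢l =
      meet-unique k≢l (subst (α (meet k l) I_) βk≡k (I-preserved (meet-I₁ k l)))
                      (subst (α (meet k l) I_) βl≡l (I-preserved (meet-I₂ k l)))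

    fixed-flag : Σ Point λ p → Σ Line λ l → p I l × α p ≡ p × β l ≡ l
    fixed-flag with fixed-line-through (off₁≢off₂ line₀)
    ... | m , βm≡m , _ with fixed-line-through (off₁≢off₂ m)
    ... | k , βk≡k , off∈k = meet k m , m , meet-I₂ k m , fixed-lines-meet-fixed βk≡k βm≡m k≢m , βm≡m
      where
      k≢m : k ≢ m
      k≢m = [ (λ off₁∈k → ∈-∉⇒≢ off₁∈k (off₁-∉ m)) , (λ off₂∈k → ∈-∉⇒≢ off₂∈k (off₂-∉ m)) ]′ off∈k

  Flag : Set
  Flag = Σ (Point × Line) (λ pl → proj₁ pl I proj₂ pl)

  pt : Flag → Point
  pt x = proj₁ (proj₁ x)

  ln : Flag → Line
  ln x = proj₂ (proj₁ x)

  flag-≡ : ∀ {x y} → pt x ≡ pt y → ln x ≡ ln y → x ≡ y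
  flag-≡ {(p , l) , i} {(.p , .l) , j} refl refl = cong ((p , l) ,_) (I-irrelevant i j)

  _≟ᶠ_ : DecidableEquality Flag
  _≟ᶠ_ = ≡-dec (≡-dec _≟ₚ_ _≟ₗ_) (λ i j → yes (I-irrelevant i j))

  module Polarity
    (π : Point → Line) (ρ : Line → Point) (π∘ρ : ∀ l → π (ρ l) ≡ l)
    (polar       : ∀ {p q} → q I π p → p I π q)
    (no-absolute : ∀ p → ¬ p I π p)
    where

    φ : Flag → Flag
    φ x = (meet (ln x) (π (pt x)) , π (pt x)) , meet-I₂ (ln x) (π (pt x))

    φ-fixed-point-free : ∀ x → φ x ≢ x
    φ-fixed-point-free x φx≡x = no-absolute (pt x) (subst (pt x I_) (sym (cong ln φx≡x)) (proj₂ x))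

    φ-pt : ∀ x {p r} → ln x ≡ π p → r I π p → r I π (pt x) → pt (φ x) ≡ r
    φ-pt x {p} {r} lx≡πp r∈πp r∈πx = sym (meet-unique lx≢πx (subst (r I_) (sym lx≡πp) r∈πp) r∈πx)
      where
      lx≢πx : ln x ≢ π (pt x)
      lx≢πx lx≡πx = no-absolute (pt x) (subst (pt x I_) lx≡πx (proj₂ x))

    -- p, q, r form a self-polar triangle and φ cycles its flags (q , π p), (r , π q), (p , π r).
    φ³≡id : ∀ x → φ (φ (φ x)) ≡ x
    φ³≡id x = flag-≡ φφφx-pt (trans (cong π φφx-pt) (π∘ρ (ln x)))
      where
      p q r : Point
      p = ρ (ln x)
      q = pt x
      r = pt (φ x)
      lx≡πp : ln x ≡ π p
      lx≡πp = sym (π∘ρ (ln x))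
      q∈πp : q I π p
      q∈πp = subst (q I_) lx≡πp (proj₂ x)
      r∈πp : r I π p
      r∈πp = subst (r I_) lx≡πp (meet-I₁ (ln x) (π q))
      r∈πq : r I π q
      r∈πq = meet-I₂ (ln x) (π q)
      φφx-pt : pt (φ (φ x)) ≡ p
      φφx-pt = φ-pt (φ x) refl (polar q∈πp) (polar r∈πp)
      φφφx-pt : pt (φ (φ (φ x))) ≡ q
      φφφx-pt = φ-pt (φ (φ x)) refl (polar r∈πq) (subst (λ s → q I π s) (sym φφx-pt) q∈πp)

    3∣number-of-flags : ∀ xs → Unique xs → (∀ x → x ∈ xs) → 3 ∣ length xs
    3∣number-of-flags = fixed-point-free-order-3⇒3∣length _≟ᶠ_ φ φ³≡id φ-fixed-point-free

  Adjacent : Flag → Flag → Set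
  Adjacent x y = ¬ proj₁ x ≡ proj₁ y × (pt x ≡ pt y ⊎ ln x ≡ ln y)

  adjacent : ∀ {x y} → x ≢ y → pt x ≡ pt y ⊎ ln x ≡ ln y → Adjacent x y
  adjacent x≢y shared = (λ xy≡ → x≢y (flag-≡ (cong proj₁ xy≡) (cong proj₂ xy≡))) , shared

  adjacent⇒≢ : ∀ {x y} → Adjacent x y → x ≢ y
  adjacent⇒≢ (x≢y , _) refl = x≢y refl

  adjacent-sym : ∀ {x y} → Adjacent x y → Adjacent y x
  adjacent-sym {x} {y} x~y@(_ , shared) =
    adjacent (adjacent⇒≢ {x} {y} x~y ∘ sym) ([ inj₁ ∘ sym , inj₂ ∘ sym ]′ shared)

  samePoint : Flag → Flag → Bool
  samePoint x y = does (pt x ≟ₚ pt y)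

  samePoint-sym : ∀ x y → samePoint x y ≡ samePoint y x
  samePoint-sym x y with pt x ≟ₚ pt y | pt y ≟ₚ pt x
  ... | yes _    | yes _    = refl
  ... | no _     | no _     = refl
  ... | yes x≡y  | no y≢x   = contradiction (sym x≡y) y≢x
  ... | no x≢y   | yes y≡x  = contradiction (sym y≡x) x≢y

  samePoint-true : ∀ {x y} → pt x ≡ pt y → samePoint x y ≡ true
  samePoint-true {x} {y} x≡y with pt x ≟ₚ pt y
  ... | yes _   = refl
  ... | no x≢y  = contradiction x≡y x≢y

  samePoint-false : ∀ {x y} → x ≢ y → ln x ≡ ln y → samePoint x y ≡ false
  samePoint-false {x} {y} x≢y lx≡ly with pt x ≟ₚ pt y
  ... | yes px≡py = contradiction (flag-≡ px≡py lx≡ly) x≢y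
  ... | no _      = refl

  samePoint-true⁻¹ : ∀ {x y} → samePoint x y ≡ true → pt x ≡ pt y
  samePoint-true⁻¹ {x} {y} eq with pt x ≟ₚ pt y
  ... | yes px≡py = px≡py

  samePoint-false⁻¹ : ∀ {x y} → Adjacent x y → samePoint x y ≡ false → ln x ≡ ln y
  samePoint-false⁻¹ {x} {y} (_ , shared) eq with pt x ≟ₚ pt y | shared
  ... | no px≢py | inj₁ px≡py = contradiction px≡py px≢py
  ... | no _     | inj₂ lx≡ly = lx≡ly

  pt≢⇒ln≡ : ∀ {x y} → Adjacent x y → pt x ≢ pt y → ln x ≡ ln y
  pt≢⇒ln≡ (_ , inj₁ px≡py) px≢py = contradiction px≡py px≢py
  pt≢⇒ln≡ (_ , inj₂ lx≡ly) _     = lx≡ly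

  mixed-kinds⇒non-adjacent : ∀ {x y z} → Adjacent x y → Adjacent x z →
                             pt x ≡ pt y → pt x ≢ pt z → ¬ Adjacent y z
  mixed-kinds⇒non-adjacent _ _ px≡py px≢pz (_ , inj₁ py≡pz) = px≢pz (trans px≡py py≡pz)
  mixed-kinds⇒non-adjacent {x} {y} {z} x~y x~z px≡py px≢pz (_ , inj₂ ly≡lz) =
    adjacent⇒≢ {x} {y} x~y (flag-≡ px≡py (trans (pt≢⇒ln≡ {x} {z} x~z px≢pz) (sym ly≡lz)))

  same-kind⇒adjacent : ∀ {x y z} → Adjacent x y → Adjacent x z → y ≢ z →
                       samePoint x y ≡ samePoint x z → Adjacent y z
  same-kind⇒adjacent {x} {y} {z} x~y x~z y≢z eq with pt x ≟ₚ pt y | pt x ≟ₚ pt z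
  same-kind⇒adjacent x~y x~z y≢z eq | yes px≡py | yes px≡pz =
    adjacent y≢z (inj₁ (trans (sym px≡py) px≡pz))
  same-kind⇒adjacent {x} {y} {z} x~y x~z y≢z eq | no px≢py  | no px≢pz  =
    adjacent y≢z (inj₂ (trans (sym (pt≢⇒ln≡ {x} {y} x~y px≢py)) (pt≢⇒ln≡ {x} {z} x~z px≢pz)))
  same-kind⇒adjacent x~y x~z y≢z () | yes _ | no _
  same-kind⇒adjacent x~y x~z y≢z () | no _  | yes _

  adjacent⇒same-kind : ∀ {x y z} → Adjacent x y → Adjacent x z → Adjacent y z →
                       samePoint x y ≡ samePoint x z
  adjacent⇒same-kind {x} {y} {z} x~y x~z y~z with pt x ≟ₚ pt y | pt x ≟ₚ pt z
  ... | yes _     | yes _     = refl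
  ... | no _      | no _      = refl
  ... | yes px≡py | no px≢pz  =
    contradiction y~z (mixed-kinds⇒non-adjacent {x} {y} {z} x~y x~z px≡py px≢pz)
  ... | no px≢py  | yes px≡pz =
    contradiction (adjacent-sym {y} {z} y~z) (mixed-kinds⇒non-adjacent {x} {z} {y} x~z x~y px≡pz px≢py)

  flag-at : Point → Flag
  flag-at p = (p , join p p) , join-I₁ p p

  flag-on : Line → Flag
  flag-on l = (meet l l , l) , meet-I₁ l l

  x₀ y₀ : Flag
  x₀ = (off₁ line₀ , join (off₁ line₀) (off₂ line₀)) , join-I₁ (off₁ line₀) (off₂ line₀)
  y₀ = (off₂ line₀ , join (off₁ line₀) (off₂ line₀)) , join-I₂ (off₁ line₀) (off₂ line₀)

  x₀~y₀ : Adjacent x₀ y₀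
  x₀~y₀ = adjacent (off₁≢off₂ line₀ ∘ cong pt {x₀} {y₀}) (inj₂ refl)

  module LineGraphInvolution (τ : FixedPointFreeInvolution Flag Adjacent) where
    open FixedPointFreeInvolution τ

    σ-injective : ∀ {x y} → σ x ≡ σ y → x ≡ y
    σ-injective {x} {y} σx≡σy = trans (sym (σ-involutive x)) (trans (cong σ σx≡σy) (σ-involutive y))

    σ-adj⁻¹ : ∀ {x y} → Adjacent (σ x) (σ y) → Adjacent x y
    σ-adj⁻¹ {x} {y} σx~σy = subst₂ Adjacent (σ-involutive x) (σ-involutive y) (σ-adj σx~σy)

    change : Flag → Flag → Bool
    change x y = samePoint x y xor samePoint (σ x) (σ y)

    change-sym : ∀ x y → change x y ≡ change y x
    change-sym x y = cong₂ _xor_ (samePoint-sym x y) (samePoint-sym (σ x) (σ y))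

    -- Neighbours y, z of x share a kind of adjacency with x iff they are adjacent, which σ preserves.
    change-local : ∀ {x y z} → Adjacent x y → Adjacent x z → change x y ≡ change x z
    change-local {x} {y} {z} x~y x~z with y ≟ᶠ z
    ... | yes refl = refl
    ... | no y≢z   = xor-≡
      (λ same → adjacent⇒same-kind {σ x} {σ y} {σ z} (σ-adj x~y) (σ-adj x~z)
        (σ-adj (same-kind⇒adjacent {x} {y} {z} x~y x~z y≢z same)))
      (λ same → adjacent⇒same-kind {x} {y} {z} x~y x~z
        (σ-adj⁻¹ (same-kind⇒adjacent {σ x} {σ y} {σ z} (σ-adj x~y) (σ-adj x~z) (y≢z ∘ σ-injective) same)))

    ChangeAt : Bool → Flag → Set
    ChangeAt b x = ∀ {y} → Adjacent x y → change x y ≡ b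

    ChangeAt-step : ∀ {b x w} → ChangeAt b x → Adjacent x w → ChangeAt b w
    ChangeAt-step {x = x} {w} at-x x~w w~y =
      trans (change-local w~y (adjacent-sym {x} {w} x~w)) (trans (change-sym w x) (at-x x~w))

    ChangeAt-move : ∀ {b x w} → ChangeAt b x → pt x ≡ pt w ⊎ ln x ≡ ln w → ChangeAt b w
    ChangeAt-move {x = x} {w} at-x shared with x ≟ᶠ w
    ... | yes refl = at-x
    ... | no x≢w   = ChangeAt-step at-x (adjacent x≢w shared)

    ChangeAt-everywhere : ∀ {b x} → ChangeAt b x → ∀ w → ChangeAt b w
    ChangeAt-everywhere {x = x} at-x w =
      ChangeAt-move {w = w} (ChangeAt-move {w = via-w}
        (ChangeAt-move {w = via-x} at-x (inj₁ refl)) (inj₂ refl)) (inj₁ refl)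
      where
      via-x : Flag
      via-x = (pt x , join (pt x) (pt w)) , join-I₁ (pt x) (pt w)
      via-w : Flag
      via-w = (pt w , join (pt x) (pt w)) , join-I₂ (pt x) (pt w)

    change-constant : ∀ {x y u v} → Adjacent x y → Adjacent u v → change u v ≡ change x y
    change-constant {x} {y} {u} x~y u~v = ChangeAt-everywhere {x = x} (λ x~z → change-local x~z x~y) u u~v

    module Preserving (preserves : ∀ {x y} → Adjacent x y → samePoint (σ x) (σ y) ≡ samePoint x y) where

      pt≡⇒σ-pt≡ : ∀ {x y} → pt x ≡ pt y → pt (σ x) ≡ pt (σ y)
      pt≡⇒σ-pt≡ {x} {y} px≡py with x ≟ᶠ y
      ... | yes refl = refl
      ... | no x≢y   = samePoint-true⁻¹ {σ x} {σ y}
        (trans (preserves (adjacent x≢y (inj₁ px≡py))) (samePoint-true {x} {y} px≡py))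

      ln≡⇒σ-ln≡ : ∀ {x y} → ln x ≡ ln y → ln (σ x) ≡ ln (σ y)
      ln≡⇒σ-ln≡ {x} {y} lx≡ly with x ≟ᶠ y
      ... | yes refl = refl
      ... | no x≢y   = samePoint-false⁻¹ {σ x} {σ y} (σ-adj x~y)
        (trans (preserves x~y) (samePoint-false {x} {y} x≢y lx≡ly))
        where
        x~y : Adjacent x y
        x~y = adjacent x≢y (inj₂ lx≡ly)

      α : Point → Point
      α p = pt (σ (flag-at p))

      β : Line → Line
      β l = ln (σ (flag-on l))

      σ-pt : ∀ x → pt (σ x) ≡ α (pt x)
      σ-pt x = pt≡⇒σ-pt≡ {x} {flag-at (pt x)} refl

      σ-ln : ∀ x → ln (σ x) ≡ β (ln x)
      σ-ln x = ln≡⇒σ-ln≡ {x} {flag-on (ln x)} refl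

      α-involutive : ∀ p → α (α p) ≡ p
      α-involutive p = trans (sym (σ-pt (σ (flag-at p)))) (cong pt (σ-involutive (flag-at p)))

      I-preserved : ∀ {p l} → p I l → α p I β l
      I-preserved {p} {l} p∈l = subst₂ _I_ (σ-pt x) (σ-ln x) (proj₂ (σ x))
        where
        x : Flag
        x = (p , l) , p∈l

      impossible : ⊥
      impossible with Collineation.fixed-flag α β α-involutive I-preserved
      ... | p , l , p∈l , αp≡p , βl≡l = σ-fixed-point-free x (flag-≡ (trans (σ-pt x) αp≡p) (trans (σ-ln x) βl≡l))
        where
        x : Flag
        x = (p , l) , p∈l

    module Reversing (reverses : ∀ {x y} → Adjacent x y → samePoint (σ x) (σ y) ≡ not (samePoint x y)) where

      pt≡⇒σ-ln≡ : ∀ {x y} → pt x ≡ pt y → ln (σ x) ≡ ln (σ y)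
      pt≡⇒σ-ln≡ {x} {y} px≡py with x ≟ᶠ y
      ... | yes refl = refl
      ... | no x≢y   = samePoint-false⁻¹ {σ x} {σ y} (σ-adj x~y)
        (trans (reverses x~y) (cong not (samePoint-true {x} {y} px≡py)))
        where
        x~y : Adjacent x y
        x~y = adjacent x≢y (inj₁ px≡py)

      ln≡⇒σ-pt≡ : ∀ {x y} → ln x ≡ ln y → pt (σ x) ≡ pt (σ y)
      ln≡⇒σ-pt≡ {x} {y} lx≡ly with x ≟ᶠ y
      ... | yes refl = refl
      ... | no x≢y   = samePoint-true⁻¹ {σ x} {σ y}
        (trans (reverses (adjacent x≢y (inj₂ lx≡ly))) (cong not (samePoint-false {x} {y} x≢y lx≡ly)))

      π : Point → Line
      π p = ln (σ (flag-at p))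

      ρ : Line → Point
      ρ l = pt (σ (flag-on l))

      σ-pt : ∀ x → pt (σ x) ≡ ρ (ln x)
      σ-pt x = ln≡⇒σ-pt≡ {x} {flag-on (ln x)} refl

      σ-ln : ∀ x → ln (σ x) ≡ π (pt x)
      σ-ln x = pt≡⇒σ-ln≡ {x} {flag-at (pt x)} refl

      π∘ρ : ∀ l → π (ρ l) ≡ l
      π∘ρ l = trans (sym (σ-ln (σ (flag-on l)))) (cong ln (σ-involutive (flag-on l)))

      ρ∘π : ∀ p → ρ (π p) ≡ p
      ρ∘π p = trans (sym (σ-pt (σ (flag-at p)))) (cong pt (σ-involutive (flag-at p)))

      polar : ∀ {p q} → q I π p → p I π q
      polar {p} {q} q∈πp = subst₂ _I_ (trans (σ-pt x) (ρ∘π p)) (σ-ln x) (proj₂ (σ x))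
        where
        x : Flag
        x = (q , π p) , q∈πp

      no-absolute : ∀ p → ¬ p I π p
      no-absolute p p∈πp = σ-fixed-point-free x (flag-≡ (trans (σ-pt x) (ρ∘π p)) (σ-ln x))
        where
        x : Flag
        x = (p , π p) , p∈πp

      open Polarity π ρ π∘ρ polar no-absolute public using (3∣number-of-flags)

    3∣number-of-flags : ∀ xs → Unique xs → (∀ x → x ∈ xs) → 3 ∣ length xs
    3∣number-of-flags with change x₀ y₀ in eq
    ... | false = ⊥-elim (Preserving.impossible λ x~y → xor≡false⇒≡ (trans (change-constant x₀~y₀ x~y) eq))
    ... | true  = Reversing.3∣number-of-flags λ x~y → xor≡true⇒≡not (trans (change-constant x₀~y₀ x~y) eq)

  line-graph-fixed-point-free-involution⇒3∣number-of-flags :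
    FixedPointFreeInvolution Flag Adjacent → ∀ xs → Unique xs → (∀ x → x ∈ xs) → 3 ∣ length xs
  line-graph-fixed-point-free-involution⇒3∣number-of-flags = LineGraphInvolution.3∣number-of-flags

-- The plane PG(2,3)

open Defs using (Point; Line; Flag)

point-001 : Point
point-001 = (zero , zero , suc zero) , refl

point-01 : F₃ → Point
point-01 c = (zero , suc zero , c) , refl

point-1 : F₃ × F₃ → Point
point-1 (b , c) = (suc zero , b , c) , refl

points : List Point
points = point-001 ∷ map point-01 (allFin 3) ++ map point-1 (cartesianProduct (allFin 3) (allFin 3))

∈-points : ∀ p → p ∈ points
∈-points ((zero , zero , suc zero) , refl) = here refl
∈-points ((zero , suc zero , c) , refl) = there (∈-++⁺ˡ (∈-map⁺ point-01 (∈-allFin c)))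
∈-points ((suc zero , b , c) , refl) =
  there (∈-++⁺ʳ (map point-01 (allFin 3)) (∈-map⁺ point-1 (∈-cartesianProduct⁺ (∈-allFin b) (∈-allFin c))))
∈-points ((zero , zero , zero) , ())
∈-points ((zero , zero , suc (suc zero)) , ())
∈-points ((zero , suc (suc zero) , _) , ())
∈-points ((suc (suc zero) , _ , _) , ())

_≟ₚ_ : DecidableEquality Point
_≟ₚ_ = ≡-dec (≡-dec Fin._≟_ (≡-dec Fin._≟_ Fin._≟_)) (λ i j → yes (≡-irrelevant i j))

_I?_ : ∀ p l → Dec (Incident p l)
p I? l = _ Bool.≟ true

∀? : ∀ {P : Point → Set} → Decidable P → Dec (∀ p → P p)
∀? P? = map′ (λ all p → All.lookup all (∈-points p)) (λ ∀P → All.tabulate λ {p} _ → ∀P p) (All.all? P? points)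

-- The default point-001 is junk; join-incident and off-lines below show that every search used here succeeds.
search : ∀ {P : Point → Set} → Decidable P → Point
search P? = fromMaybe point-001 (find P? points)

join : Point → Point → Line
join p q = search λ l → p I? l ×-dec q I? l

join-incident : ∀ p q → Incident p (join p q) × Incident q (join p q)
join-incident = from-yes (∀? λ p → ∀? λ q → p I? join p q ×-dec q I? join p q)

join-unique : ∀ p q l → p ≢ q → Incident p l → Incident q l → l ≡ join p q
join-unique = from-yes (∀? λ p → ∀? λ q → ∀? λ l →
  ¬? (p ≟ₚ q) →-dec (p I? l →-dec (q I? l →-dec (l ≟ₚ join p q))))

dot-comm : ∀ v w → dot v w ≡ dot w v
dot-comm (a , b , c) (x , y , z) =
  cong₂ _+_ (cong₂ _+_ (*-comm (toℕ a) (toℕ x)) (*-comm (toℕ b) (toℕ y))) (*-comm (toℕ c) (toℕ z))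

I-sym : ∀ p l → Incident p l → Incident l p
I-sym (v , _) (w , _) = subst (λ n → ((n % 3) ≡ᵇ 0) ≡ true) (dot-comm v w)

off₁ : Line → Point
off₁ l = search λ p → ¬? (p I? l)

off₂ : Line → Point
off₂ l = search λ p → ¬? (p I? l) ×-dec ¬? (p ≟ₚ off₁ l)

off-lines : ∀ l → ¬ Incident (off₁ l) l × ¬ Incident (off₂ l) l × off₁ l ≢ off₂ l
off-lines = from-yes (∀? λ l → ¬? (off₁ l I? l) ×-dec ¬? (off₂ l I? l) ×-dec ¬? (off₁ l ≟ₚ off₂ l))

PG[2,3] : ProjectivePlane
PG[2,3] = record
  { Point = Point
  ; Line = Line
  ; _I_ = Incident
  ; I-irrelevant = ≡-irrelevant
  ; _≟ₚ_ = _≟ₚ_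
  ; _≟ₗ_ = _≟ₚ_
  ; join = join
  ; join-I₁ = λ p q → proj₁ (join-incident p q)
  ; join-I₂ = λ p q → proj₂ (join-incident p q)
  ; join-unique = λ {p} {q} {l} → join-unique p q l
  -- Incidence v · w ≡ 0 is symmetric, so the plane is self-dual and meets are joins.
  ; meet = join
  ; meet-I₁ = λ l m → I-sym l (join l m) (proj₁ (join-incident l m))
  ; meet-I₂ = λ l m → I-sym m (join l m) (proj₂ (join-incident l m))
  ; meet-unique = λ {l} {m} {p} l≢m p∈l p∈m → join-unique l m p l≢m (I-sym p l p∈l) (I-sym p m p∈m)
  ; line₀ = point-001
  ; off₁ = off₁
  ; off₂ = off₂
  ; off₁-∉ = λ l → proj₁ (off-lines l)
  ; off₂-∉ = λ l → proj₁ (proj₂ (off-lines l))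
  ; off₁≢off₂ = λ l → proj₂ (proj₂ (off-lines l))
  }

open ProjectivePlaneProperties PG[2,3] hiding (Flag)

flags-at : Point → Line → List Flag
flags-at p l with p I? l
... | yes p∈l = [ (p , l) , p∈l ]
... | no _    = []

flags-through : Point → List Flag
flags-through p = concatMap (flags-at p) points

flags : List Flag
flags = concatMap flags-through points

∈-flags : ∀ x → x ∈ flags
∈-flags x@((p , l) , p∈l) = ∈-concatMap⁺ flags-through (Any.map ∈-flags-through (∈-points p))
  where
  ∈-flags-at : ∀ {m} → l ≡ m → x ∈ flags-at p m
  ∈-flags-at refl with p I? l
  ... | yes p∈l′ = here (cong ((p , l) ,_) (≡-irrelevant p∈l p∈l′))
  ... | no p∉l   = contradiction p∈l p∉l

  ∈-flags-through : ∀ {q} → p ≡ q → x ∈ flags-through q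
  ∈-flags-through refl = ∈-concatMap⁺ (flags-at p) (Any.map ∈-flags-at (∈-points l))

flags-unique : Unique flags
flags-unique = from-yes (unique? _≟ᶠ_ flags)

proposition3p9 : ¬ IsCayleyGraph Flag LineGraphAdj
proposition3p9 cayley =
  3∤|flags| (line-graph-fixed-point-free-involution⇒3∣number-of-flags σ flags flags-unique ∈-flags)
  where
  2∣|flags| : 2 ∣ length flags
  2∣|flags| = from-yes (2 ∣? 52)

  3∤|flags| : ¬ 3 ∣ length flags
  3∤|flags| = from-no (3 ∣? 52)

  σ : FixedPointFreeInvolution Flag LineGraphAdj
  σ = cayley⇒fixed-point-free-involution cayley _≟ᶠ_ flags flags-unique ∈-flags 2∣|flags|
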